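{- Let $G$ be a simple graph with $n \geq 5$ vertices and $m$ edges, with degree sequence $\Delta = d_1 \geq d_2 \geq \cdots \geq d_{n-1} \geq d_n = \delta > 0$. Then \[ {}^{m}M_1(G) \geq \frac{1}{\Delta^2} + \frac{1}{\delta^2} + \frac{\left(ID(G) - \frac{1}{\Delta} - \frac{1}{\delta}\right)^2}{n-2} + \frac{1}{2}\left(\frac{1}{d_2} - \frac{1}{d_{n-1}}\right)^2 + \frac{2(n-2)}{n-4}\left(\frac{ID(G) - \frac{1}{\Delta} - \frac{1}{\delta}}{n-2} - \frac{\frac{1}{d_2} + \frac{1}{d_{n-1}}}{2}\right)^2. \] Equality holds if and only if $G$ is regular, or $G \in \Gamma_{3,n-2}$, or $G \in \Gamma_{2,n-2}$, or $G \in \Gamma_{3,n-1}$, or $G \in \Gamma_{2,n-1}$, or $G \in \Gamma_{3,n}$, or $G \in \Gamma_{2,n}$, or $G \in \Gamma_{1,n-2}$, or $G \in \Gamma_{1,n-1}$.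
   Context: ${}^{m}M_1(G) = \sum_{i=1}^n \frac{1}{d_i^2}$, $ID(G) = \sum_{i=1}^n \frac{1}{d_i}$. For $1 \le i < j \le n$, $\Gamma_{i,j}$ denotes the class of graphs (with vertices ordered so that $d_1 \ge \cdots \ge d_n$) such that $d_i = d_{i+1} = \cdots = d_j$. -}

module Defs where

open import Data.Bool using (Bool; true; false; if_then_else_)
open import Data.Nat using (ℕ; zero; suc; _<?_; _≤_; _+_)
open import Data.Fin using (Fin; fromℕ<) renaming (zero to fz; suc to fs)
open import Data.Integer using (+_)
open import Data.Rational using (ℚ; 0ℚ; _/_) renaming (_+_ to _+ℚ_)
open import Relation.Binary.PropositionalEquality using (_≡_)
open import Relation.Nullary using (yes; no)

record Graph (n : ℕ) : Set where
  field
    adj    : Fin n → Fin n → Bool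
    sym    : ∀ u v → adj u v ≡ adj v u
    irrefl : ∀ v → adj v v ≡ false
open Graph public

Σℕ : ∀ {n} → (Fin n → ℕ) → ℕ
Σℕ {zero}  f = 0
Σℕ {suc n} f = f fz + Σℕ (λ i → f (fs i))

Σℚ : ∀ {n} → (Fin n → ℚ) → ℚ
Σℚ {zero}  f = 0ℚ
Σℚ {suc n} f = f fz +ℚ Σℚ (λ i → f (fs i))

deg : ∀ {n} → Graph n → Fin n → ℕ
deg G v = Σℕ (λ w → if adj G v w then 1 else 0)

-- degree sequence, 1-indexed as in the paper: d G i = d_i for 1 ≤ i ≤ n
-- (vertex number i-1 in Fin n); value 0 outside that range (never used).
d : ∀ {n} → Graph n → ℕ → ℕ
d {n} G zero = 0
d {n} G (suc i) with i <? n
... | yes p = deg G (fromℕ< p)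
... | no _  = 0

-- reciprocal 1/k as a rational (k = 0 mapped to 0; only used for k ≥ 1)
inv : ℕ → ℚ
inv zero    = 0ℚ
inv (suc k) = + 1 / suc k

ℕ→ℚ : ℕ → ℚ
ℕ→ℚ k = + k / 1

mM1 : ∀ {n} → Graph n → ℚ
mM1 G = Σℚ (λ v → inv (deg G v) Data.Rational.* inv (deg G v))

ID : ∀ {n} → Graph n → ℚ
ID G = Σℚ (λ v → inv (deg G v))

DegNonincreasing : ∀ {n} → Graph n → Set
DegNonincreasing {n} G = ∀ i j → 1 ≤ i → i ≤ j → j Data.Nat.≤ n → d G j ≤ d G i

Regular : ∀ {n} → Graph n → Set
Regular G = ∀ u v → deg G u ≡ deg G v

InΓ : ∀ {n} → Graph n → ℕ → ℕ → Set
InΓ G i j = ∀ k → i ≤ k → k ≤ j → d G k ≡ d G i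

-- Write p, a, b, r for the reciprocals of d₁, d₂, d_{n−1}, d_n, and y₁, …, y_k for those of the
-- k = n − 4 middle degrees d₃, …, d_{n−2}; put M = Σ yⱼ, so that ID(G) − p − r = a + b + M.  The last
-- three terms of the bound then collapse to a² + b² + M²/k, so the inequality is QM–AM for the yⱼ,
-- M²/k ≤ Σ yⱼ², whose excess is Σ (yⱼ − M/k)².  Hence equality holds iff d₃ = ⋯ = d_{n−2}, i.e.
-- G ∈ Γ_{3,n−2}, and each of the listed classes is contained in Γ_{3,n−2}.

module Submission where

open import Defs
open import Data.Nat using (ℕ; _≤_; _∸_; _*_)
open import Data.Rational using (ℚ) renaming (_+_ to _+ℚ_; _-_ to _-ℚ_; _*_ to _*ℚ_; _≤_ to _≤ℚ_)
open import Data.Product using (_×_)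
open import Data.Sum using (_⊎_)
open import Function.Bundles using (_⇔_)
open import Relation.Binary.PropositionalEquality using (_≡_)

open import Data.Fin using (Fin; toℕ; fromℕ<) renaming (zero to fz; suc to fs)
import Data.Fin.Properties as Finₚ
open import Data.Integer as ℤ using (+_; +[1+_]; -[1+_])
import Data.Integer.Properties as ℤₚ
open import Data.Nat as ℕ using (zero; suc; z≤n; s≤s)
open import Data.Nat.Coprimality as Coprime using (1-coprimeTo)
import Data.Nat.Properties as ℕₚ
open import Data.Product using (_,_; map₂)
open import Data.Rational as ℚ using (mkℚ; 0ℚ; 1ℚ; ↥_; toℚᵘ) renaming (_<_ to _<ℚ_)
import Data.Rational.Properties as ℚₚ
open import Data.Rational.Solver using (module +-*-Solver)
open import Algebra.Properties.Group ℚₚ.+-0-group using (∙-cancelˡ; x∙y⁻¹≈ε⇒x≈y)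
import Data.Rational.Unnormalised as ℚᵘ
import Data.Rational.Unnormalised.Properties as ℚᵘₚ
open import Data.Sum using (inj₁; inj₂; [_,_]′)
open import Function using (_∘_; id)
open import Function.Bundles using (mk⇔; Equivalence)
import Function.Properties.Equivalence as ⇔
open import Relation.Binary.PropositionalEquality using (refl; cong; cong₂; trans; module ≡-Reasoning)
import Relation.Binary.PropositionalEquality as ≡
open import Relation.Nullary using (yes; no; contradiction)

open +-*-Solver

ℕ→ℚ-mkℚ : ∀ k → ℕ→ℚ k ≡ mkℚ (+ k) 0 (Coprime.sym (1-coprimeTo k))
ℕ→ℚ-mkℚ k = ℚₚ.normalize-coprime (Coprime.sym (1-coprimeTo k))

inv-suc : ∀ k → inv (suc k) ≡ mkℚ (+ 1) k (1-coprimeTo (suc k))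
inv-suc k = ℚₚ.normalize-coprime (1-coprimeTo (suc k))

ℕ→ℚ-*-inv : ∀ k → ℕ→ℚ (suc k) *ℚ inv (suc k) ≡ 1ℚ
ℕ→ℚ-*-inv k = trans (cong₂ _*ℚ_ (ℕ→ℚ-mkℚ (suc k)) (inv-suc k))
  (ℚₚ.*-inverseʳ (mkℚ (+ suc k) 0 (Coprime.sym (1-coprimeTo (suc k)))))

inv-injective : ∀ a b → inv a ≡ inv b → a ≡ b
inv-injective zero    zero    _ = refl
inv-injective zero    (suc b) e with () ← cong ↥_ (trans e (inv-suc b))
inv-injective (suc a) zero    e with () ← cong ↥_ (trans (≡.sym e) (inv-suc a))
inv-injective (suc a) (suc b) e =
  cong (suc ∘ ℚ.denominator-1) (trans (≡.sym (inv-suc a)) (trans e (inv-suc b)))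

ℕ→ℚ-+ : ∀ a b → ℕ→ℚ (a ℕ.+ b) ≡ ℕ→ℚ a +ℚ ℕ→ℚ b
ℕ→ℚ-+ a b = ℚₚ.toℚᵘ-injective (begin
  toℚᵘ (ℕ→ℚ (a ℕ.+ b))                   ≈⟨ toℚᵘ-ℕ→ℚ (a ℕ.+ b) ⟩
  ℚᵘ.mkℚᵘ (+ (a ℕ.+ b)) 0                ≈⟨ ℚᵘ.*≡* (cong (ℤ._* + 1) numerators) ⟩
  ℚᵘ.mkℚᵘ (+ a) 0 ℚᵘ.+ ℚᵘ.mkℚᵘ (+ b) 0   ≈⟨ ℚᵘₚ.+-cong (ℚᵘₚ.≃-sym (toℚᵘ-ℕ→ℚ a)) (ℚᵘₚ.≃-sym (toℚᵘ-ℕ→ℚ b)) ⟩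
  toℚᵘ (ℕ→ℚ a) ℚᵘ.+ toℚᵘ (ℕ→ℚ b)         ≈⟨ ℚᵘₚ.≃-sym (ℚₚ.toℚᵘ-homo-+ (ℕ→ℚ a) (ℕ→ℚ b)) ⟩
  toℚᵘ (ℕ→ℚ a +ℚ ℕ→ℚ b)                  ∎)
  where
  open ℚᵘₚ.≃-Reasoning
  toℚᵘ-ℕ→ℚ : ∀ k → toℚᵘ (ℕ→ℚ k) ℚᵘ.≃ ℚᵘ.mkℚᵘ (+ k) 0
  toℚᵘ-ℕ→ℚ k = ℚₚ.toℚᵘ-fromℚᵘ (ℚᵘ.mkℚᵘ (+ k) 0)
  numerators : + (a ℕ.+ b) ≡ + a ℤ.* + 1 ℤ.+ + b ℤ.* + 1
  numerators = trans (ℤₚ.pos-+ a b) (≡.sym (cong₂ ℤ._+_ (ℤₚ.*-identityʳ (+ a)) (ℤₚ.*-identityʳ (+ b))))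

x≡0⊎0<x*x : ∀ x → x ≡ 0ℚ ⊎ 0ℚ <ℚ x *ℚ x
x≡0⊎0<x*x x@(mkℚ (+ 0)    _ _) = inj₁ (ℚₚ.↥p≡0⇒p≡0 x refl)
x≡0⊎0<x*x x@(mkℚ +[1+ _ ] _ _) = inj₂ (ℚₚ.positive⁻¹ (x *ℚ x) {{ℚₚ.pos*pos⇒pos x x}})
x≡0⊎0<x*x x@(mkℚ -[1+ _ ] _ _) = inj₂ (ℚₚ.positive⁻¹ (x *ℚ x) {{ℚₚ.neg*neg⇒pos x x}})

0≤x*x : ∀ x → 0ℚ ≤ℚ x *ℚ x
0≤x*x x with x≡0⊎0<x*x x
... | inj₁ refl = ℚₚ.≤-refl
... | inj₂ 0<x*x = ℚₚ.<⇒≤ 0<x*x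

x*x≡0⇒x≡0 : ∀ x → x *ℚ x ≡ 0ℚ → x ≡ 0ℚ
x*x≡0⇒x≡0 x x*x≡0 with x≡0⊎0<x*x x
... | inj₁ x≡0 = x≡0
... | inj₂ 0<x*x = contradiction (≡.sym x*x≡0) (ℚₚ.<⇒≢ 0<x*x)

-- An identity that holds only when e = 1 is proved as lhs ≡ rhs + (e − 1) * c with the
-- ring solver, for an explicit c; this lemma then removes the correction term.
x+[e-1]*y≡x : ∀ {e} → e ≡ 1ℚ → ∀ x y → x +ℚ (e -ℚ 1ℚ) *ℚ y ≡ x
x+[e-1]*y≡x refl = solve 2 (λ x y → x :+ (con 1ℚ :- con 1ℚ) :* y := x) refl

Σℚ-cong : ∀ {n} {f g : Fin n → ℚ} → (∀ i → f i ≡ g i) → Σℚ f ≡ Σℚ g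
Σℚ-cong {zero}  f≗g = refl
Σℚ-cong {suc n} f≗g = cong₂ _+ℚ_ (f≗g fz) (Σℚ-cong (f≗g ∘ fs))

Σℚ-const : ∀ n c → Σℚ {n} (λ _ → c) ≡ ℕ→ℚ n *ℚ c
Σℚ-const zero    c = ≡.sym (ℚₚ.*-zeroˡ c)
Σℚ-const (suc n) c = begin
  c +ℚ Σℚ {n} (λ _ → c)     ≡⟨ cong (c +ℚ_) (Σℚ-const n c) ⟩
  c +ℚ ℕ→ℚ n *ℚ c           ≡⟨ solve 2 (λ c N → c :+ N :* c := (con 1ℚ :+ N) :* c) refl c (ℕ→ℚ n) ⟩
  (1ℚ +ℚ ℕ→ℚ n) *ℚ c        ≡⟨ cong (_*ℚ c) (≡.sym (ℕ→ℚ-+ 1 n)) ⟩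
  ℕ→ℚ (suc n) *ℚ c          ∎
  where open ≡-Reasoning

Σℚ-nonNeg : ∀ {n} {f : Fin n → ℚ} → (∀ i → 0ℚ ≤ℚ f i) → 0ℚ ≤ℚ Σℚ f
Σℚ-nonNeg {zero}  f≥0 = ℚₚ.≤-refl
Σℚ-nonNeg {suc n} f≥0 = ℚₚ.+-mono-≤ (f≥0 fz) (Σℚ-nonNeg (f≥0 ∘ fs))

x+y≡0⇒x≡0 : ∀ {x y} → 0ℚ ≤ℚ x → 0ℚ ≤ℚ y → x +ℚ y ≡ 0ℚ → x ≡ 0ℚ
x+y≡0⇒x≡0 {x} {y} 0≤x 0≤y x+y≡0 = ℚₚ.≤-antisym x≤0 0≤x
  where
  open ℚₚ.≤-Reasoning
  x≤0 : x ≤ℚ 0ℚ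
  x≤0 = begin
    x        ≡⟨ ℚₚ.+-identityʳ x ⟨
    x +ℚ 0ℚ  ≤⟨ ℚₚ.+-monoʳ-≤ x 0≤y ⟩
    x +ℚ y   ≡⟨ x+y≡0 ⟩
    0ℚ       ∎

Σℚ-nonNeg-≡0 : ∀ {n} {f : Fin n → ℚ} → (∀ i → 0ℚ ≤ℚ f i) → Σℚ f ≡ 0ℚ → ∀ i → f i ≡ 0ℚ
Σℚ-nonNeg-≡0 {suc n} {f} f≥0 Σ≡0 fz = x+y≡0⇒x≡0 (f≥0 fz) (Σℚ-nonNeg (f≥0 ∘ fs)) Σ≡0
Σℚ-nonNeg-≡0 {suc n} {f} f≥0 Σ≡0 (fs i) = Σℚ-nonNeg-≡0 (f≥0 ∘ fs) tail≡0 i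
  where
  tail≡0 : Σℚ (f ∘ fs) ≡ 0ℚ
  tail≡0 = x+y≡0⇒x≡0 (Σℚ-nonNeg (f≥0 ∘ fs)) (f≥0 fz) (trans (ℚₚ.+-comm _ (f fz)) Σ≡0)

Σℚ-square-deviation : ∀ {n} (y : Fin n → ℚ) μ →
  Σℚ (λ j → (y j -ℚ μ) *ℚ (y j -ℚ μ))
    ≡ Σℚ (λ j → y j *ℚ y j) -ℚ (1ℚ +ℚ 1ℚ) *ℚ μ *ℚ Σℚ y +ℚ ℕ→ℚ n *ℚ (μ *ℚ μ)
Σℚ-square-deviation {zero}  y μ =
  solve 1 (λ μ → con 0ℚ := con 0ℚ :- (con 1ℚ :+ con 1ℚ) :* μ :* con 0ℚ :+ con 0ℚ :* (μ :* μ)) refl μ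
Σℚ-square-deviation {suc n} y μ rewrite Σℚ-square-deviation (y ∘ fs) μ | ℕ→ℚ-+ 1 n =
  solve 5 (λ a μ Q M N → (a :- μ) :* (a :- μ) :+ (Q :- (con 1ℚ :+ con 1ℚ) :* μ :* M :+ N :* (μ :* μ))
                 := a :* a :+ Q :- (con 1ℚ :+ con 1ℚ) :* μ :* (a :+ M) :+ (con 1ℚ :+ N) :* (μ :* μ))
          refl (y fz) μ (Σℚ (λ j → y (fs j) *ℚ y (fs j))) (Σℚ (y ∘ fs)) (ℕ→ℚ n)

module _ {k} (y : Fin (suc k) → ℚ) where
  private
    M : ℚ
    M = Σℚ y
    Q : ℚ
    Q = Σℚ (λ j → y j *ℚ y j)
    K : ℚ
    K = ℕ→ℚ (suc k)
    w : ℚ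
    w = inv (suc k)
    μ : ℚ
    μ = M *ℚ w
    deviation : Fin (suc k) → ℚ
    deviation j = (y j -ℚ μ) *ℚ (y j -ℚ μ)

    deviation≥0 : ∀ j → 0ℚ ≤ℚ deviation j
    deviation≥0 j = 0≤x*x (y j -ℚ μ)

    Σsquares≡ : Q ≡ (M *ℚ M) *ℚ w +ℚ Σℚ deviation
    Σsquares≡ = begin
      Q                                       ≡⟨ x+[e-1]*y≡x (ℕ→ℚ-*-inv k) Q (M *ℚ M *ℚ w) ⟨
      Q +ℚ (K *ℚ w -ℚ 1ℚ) *ℚ (M *ℚ M *ℚ w)    ≡⟨ solve 4 (λ Q M w K →
          Q :+ (K :* w :- con 1ℚ) :* (M :* M :* w)
            := M :* M :* w :+ (Q :- (con 1ℚ :+ con 1ℚ) :* (M :* w) :* M :+ K :* ((M :* w) :* (M :* w))))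
          refl Q M w K ⟩
      (M *ℚ M) *ℚ w +ℚ (Q -ℚ (1ℚ +ℚ 1ℚ) *ℚ μ *ℚ M +ℚ K *ℚ (μ *ℚ μ))
                                              ≡⟨ cong ((M *ℚ M) *ℚ w +ℚ_) (Σℚ-square-deviation y μ) ⟨
      (M *ℚ M) *ℚ w +ℚ Σℚ deviation           ∎
      where open ≡-Reasoning

    Σsquares≡⇔deviations≡0 : (Q ≡ (M *ℚ M) *ℚ w) ⇔ (Σℚ deviation ≡ 0ℚ)
    Σsquares≡⇔deviations≡0 = mk⇔
      (λ Q≡ → ∙-cancelˡ ((M *ℚ M) *ℚ w) (Σℚ deviation) 0ℚ
                (trans (≡.sym Σsquares≡) (trans Q≡ (≡.sym (ℚₚ.+-identityʳ ((M *ℚ M) *ℚ w))))))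
      (λ Σ≡0 → trans Σsquares≡ (trans (cong ((M *ℚ M) *ℚ w +ℚ_) Σ≡0) (ℚₚ.+-identityʳ ((M *ℚ M) *ℚ w))))

    deviations≡0⇒constant : Σℚ deviation ≡ 0ℚ → ∀ i j → y i ≡ y j
    deviations≡0⇒constant Σ≡0 i j = trans (y≡μ i) (≡.sym (y≡μ j))
      where
      y≡μ : ∀ i → y i ≡ μ
      y≡μ i = x∙y⁻¹≈ε⇒x≈y (y i) μ (x*x≡0⇒x≡0 (y i -ℚ μ) (Σℚ-nonNeg-≡0 deviation≥0 Σ≡0 i))

    constant⇒deviations≡0 : (∀ i j → y i ≡ y j) → Σℚ deviation ≡ 0ℚ
    constant⇒deviations≡0 constant = begin
      Σℚ deviation                 ≡⟨ Σℚ-cong deviation≡0 ⟩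
      Σℚ {suc k} (λ _ → 0ℚ)       ≡⟨ Σℚ-const (suc k) 0ℚ ⟩
      K *ℚ 0ℚ                      ≡⟨ ℚₚ.*-zeroʳ K ⟩
      0ℚ                           ∎
      where
      open ≡-Reasoning
      μ≡y₀ : μ ≡ y fz
      μ≡y₀ = begin
        M *ℚ w                 ≡⟨ cong (_*ℚ w) (trans (Σℚ-cong (λ j → constant j fz)) (Σℚ-const (suc k) (y fz))) ⟩
        (K *ℚ y fz) *ℚ w       ≡⟨ solve 3 (λ K c w → (K :* c) :* w := c :* (K :* w)) refl K (y fz) w ⟩
        y fz *ℚ (K *ℚ w)       ≡⟨ cong (y fz *ℚ_) (ℕ→ℚ-*-inv k) ⟩
        y fz *ℚ 1ℚ             ≡⟨ ℚₚ.*-identityʳ (y fz) ⟩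
        y fz                   ∎
      deviation≡0 : ∀ j → deviation j ≡ 0ℚ
      deviation≡0 j = begin
        (y j -ℚ μ) *ℚ (y j -ℚ μ)  ≡⟨ cong (λ z → (z -ℚ μ) *ℚ (z -ℚ μ)) (trans (constant j fz) (≡.sym μ≡y₀)) ⟩
        (μ -ℚ μ) *ℚ (μ -ℚ μ)      ≡⟨ cong (λ z → z *ℚ z) (ℚₚ.+-inverseʳ μ) ⟩
        0ℚ *ℚ 0ℚ                  ≡⟨⟩
        0ℚ                        ∎

  mean-square-≤ : (Σℚ y *ℚ Σℚ y) *ℚ inv (suc k) ≤ℚ Σℚ (λ j → y j *ℚ y j)
  mean-square-≤ = begin
    (M *ℚ M) *ℚ w                   ≡⟨ ℚₚ.+-identityʳ ((M *ℚ M) *ℚ w) ⟨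
    (M *ℚ M) *ℚ w +ℚ 0ℚ             ≤⟨ ℚₚ.+-monoʳ-≤ ((M *ℚ M) *ℚ w) (Σℚ-nonNeg deviation≥0) ⟩
    (M *ℚ M) *ℚ w +ℚ Σℚ deviation   ≡⟨ Σsquares≡ ⟨
    Q                               ∎
    where open ℚₚ.≤-Reasoning

  mean-square-≡⇔ : (Σℚ (λ j → y j *ℚ y j) ≡ (Σℚ y *ℚ Σℚ y) *ℚ inv (suc k)) ⇔ (∀ i j → y i ≡ y j)
  mean-square-≡⇔ = ⇔.trans Σsquares≡⇔deviations≡0 (mk⇔ deviations≡0⇒constant constant⇒deviations≡0)

-- The right-hand side of the corollary for n = k + 4, with p = 1/Δ, r = 1/δ, a = 1/d₂,
-- b = 1/d_{n−1} and I = ID(G).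
mM1-bound : ℕ → (p r a b I : ℚ) → ℚ
mM1-bound k p r a b I =
  p *ℚ p +ℚ r *ℚ r +ℚ (T *ℚ T) *ℚ inv (2 ℕ.+ k) +ℚ inv 2 *ℚ ((a -ℚ b) *ℚ (a -ℚ b))
  +ℚ (ℕ→ℚ (2 * (2 ℕ.+ k)) *ℚ inv k) *ℚ (B *ℚ B)
  where
  T : ℚ
  T = I -ℚ p -ℚ r
  B : ℚ
  B = T *ℚ inv (2 ℕ.+ k) -ℚ (a +ℚ b) *ℚ inv 2

mM1-bound-≡ : ∀ k p r a b I → let S = I -ℚ p -ℚ r -ℚ a -ℚ b in
  mM1-bound (suc k) p r a b I ≡ p *ℚ p +ℚ r *ℚ r +ℚ a *ℚ a +ℚ b *ℚ b +ℚ (S *ℚ S) *ℚ inv (suc k)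
mM1-bound-≡ k p r a b I =
  collapse (inv (3 ℕ.+ k)) (ℕ→ℚ (2 * (3 ℕ.+ k))) (inv (suc k)) Nu≡1 (ℕ→ℚ-*-inv k) c≡2N
  where
  open ≡-Reasoning
  two : ℚ
  two = 1ℚ +ℚ 1ℚ
  K : ℚ
  K = ℕ→ℚ (suc k)
  N≡2+K : ℕ→ℚ (3 ℕ.+ k) ≡ two +ℚ K
  N≡2+K = ℕ→ℚ-+ 2 (suc k)
  Nu≡1 : (two +ℚ K) *ℚ inv (3 ℕ.+ k) ≡ 1ℚ
  Nu≡1 = trans (cong (_*ℚ inv (3 ℕ.+ k)) (≡.sym N≡2+K)) (ℕ→ℚ-*-inv (2 ℕ.+ k))
  c≡2N : ℕ→ℚ (2 * (3 ℕ.+ k)) ≡ two *ℚ (two +ℚ K)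
  c≡2N = begin
    ℕ→ℚ (2 * (3 ℕ.+ k))                    ≡⟨ ℕ→ℚ-+ (3 ℕ.+ k) (3 ℕ.+ k ℕ.+ 0) ⟩
    N +ℚ ℕ→ℚ (3 ℕ.+ k ℕ.+ 0)               ≡⟨ cong (N +ℚ_) (ℕ→ℚ-+ (3 ℕ.+ k) 0) ⟩
    N +ℚ (N +ℚ 0ℚ)                         ≡⟨ solve 1 (λ N → N :+ (N :+ con 0ℚ) := (con 1ℚ :+ con 1ℚ) :* N) refl N ⟩
    two *ℚ N                               ≡⟨ cong (two *ℚ_) N≡2+K ⟩
    two *ℚ (two +ℚ K)                      ∎
    where
    N : ℚ
    N = ℕ→ℚ (3 ℕ.+ k)
  -- u, c, w stand for 1/(n − 2), 2(n − 2), 1/(n − 4), and K for n − 4.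
  collapse : ∀ u c w → (two +ℚ K) *ℚ u ≡ 1ℚ → K *ℚ w ≡ 1ℚ → c ≡ two *ℚ (two +ℚ K) →
    let T = I -ℚ p -ℚ r
        B = T *ℚ u -ℚ (a +ℚ b) *ℚ inv 2
        S = I -ℚ p -ℚ r -ℚ a -ℚ b
    in p *ℚ p +ℚ r *ℚ r +ℚ (T *ℚ T) *ℚ u +ℚ inv 2 *ℚ ((a -ℚ b) *ℚ (a -ℚ b)) +ℚ (c *ℚ w) *ℚ (B *ℚ B)
       ≡ p *ℚ p +ℚ r *ℚ r +ℚ a *ℚ a +ℚ b *ℚ b +ℚ (S *ℚ S) *ℚ w
  collapse u c w Nu≡1 Kw≡1 refl =
    trans (solve 8 (λ p r a b I K u w →
             let two = con 1ℚ :+ con 1ℚ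
                 T = I :- p :- r
                 B = T :* u :- (a :+ b) :* con (inv 2)
                 S = I :- p :- r :- a :- b
                 s = a :+ b
             in p :* p :+ r :* r :+ (T :* T) :* u :+ con (inv 2) :* ((a :- b) :* (a :- b))
                  :+ ((two :* (two :+ K)) :* w) :* (B :* B)
                := p :* p :+ r :* r :+ a :* a :+ b :* b :+ (S :* S) :* w
                  :+ ((two :+ K) :* u :- con 1ℚ) :* (T :* T :* w :+ two :* T :* T :* u :* w :- two :* T :* s :* w)
                  :+ (K :* w :- con 1ℚ) :* (s :* s :* con (inv 2) :- T :* T :* u))
             refl p r a b I K u w)
          (trans (x+[e-1]*y≡x Kw≡1 _ _) (x+[e-1]*y≡x Nu≡1 _ _))

sum-of-squares-bound : ∀ k (p r a b I Q : ℚ) (y : Fin (suc k) → ℚ) →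
  I ≡ p +ℚ (a +ℚ ((Σℚ y +ℚ b) +ℚ r)) →
  Q ≡ p *ℚ p +ℚ (a *ℚ a +ℚ ((Σℚ (λ j → y j *ℚ y j) +ℚ b *ℚ b) +ℚ r *ℚ r)) →
  mM1-bound (suc k) p r a b I ≤ℚ Q × ((Q ≡ mM1-bound (suc k) p r a b I) ⇔ (∀ i j → y i ≡ y j))
sum-of-squares-bound k p r a b I Q y refl refl =
  bound≤Q , ⇔.trans Q≡bound⇔ (mean-square-≡⇔ y)
  where
  M : ℚ
  M = Σℚ y
  Σy² : ℚ
  Σy² = Σℚ (λ j → y j *ℚ y j)
  w : ℚ
  w = inv (suc k)
  c : ℚ
  c = p *ℚ p +ℚ r *ℚ r +ℚ a *ℚ a +ℚ b *ℚ b

  bound≡ : mM1-bound (suc k) p r a b I ≡ c +ℚ (M *ℚ M) *ℚ w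
  bound≡ = trans (mM1-bound-≡ k p r a b I) (cong (λ S → c +ℚ (S *ℚ S) *ℚ w)
    (solve 5 (λ p r a b M → p :+ (a :+ ((M :+ b) :+ r)) :- p :- r :- a :- b := M) refl p r a b M))

  Q≡ : Q ≡ c +ℚ Σy²
  Q≡ = solve 5 (λ p r a b Σy² → p :* p :+ (a :* a :+ ((Σy² :+ b :* b) :+ r :* r))
                  := p :* p :+ r :* r :+ a :* a :+ b :* b :+ Σy²) refl p r a b Σy²

  bound≤Q : mM1-bound (suc k) p r a b I ≤ℚ Q
  bound≤Q = begin
    mM1-bound (suc k) p r a b I  ≡⟨ bound≡ ⟩
    c +ℚ (M *ℚ M) *ℚ w           ≤⟨ ℚₚ.+-monoʳ-≤ c (mean-square-≤ y) ⟩
    c +ℚ Σy²                     ≡⟨ Q≡ ⟨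
    Q                            ∎
    where open ℚₚ.≤-Reasoning

  Q≡bound⇔ : (Q ≡ mM1-bound (suc k) p r a b I) ⇔ (Σy² ≡ (M *ℚ M) *ℚ w)
  Q≡bound⇔ = mk⇔ (λ Q≡bound → ∙-cancelˡ c Σy² ((M *ℚ M) *ℚ w) (trans (≡.sym Q≡) (trans Q≡bound bound≡)))
                 (λ Σy²≡ → trans Q≡ (trans (cong (c +ℚ_) Σy²≡) (≡.sym bound≡)))

d-toℕ : ∀ {n} (G : Graph n) (v : Fin n) → d G (suc (toℕ v)) ≡ deg G v
d-toℕ {n} G v with toℕ v ℕ.<? n
... | yes v<n = cong (deg G) (Finₚ.toℕ-injective (Finₚ.toℕ-fromℕ< v<n))
... | no  v≮n = contradiction (Finₚ.toℕ<n v) v≮n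

d-fromℕ< : ∀ {n} (G : Graph n) {t} (t<n : t ℕ.< n) → d G (suc t) ≡ deg G (fromℕ< t<n)
d-fromℕ< G t<n = trans (cong (d G ∘ suc) (≡.sym (Finₚ.toℕ-fromℕ< t<n))) (d-toℕ G (fromℕ< t<n))

Σℚ-toℕ-snoc : ∀ n (g : ℕ → ℚ) → Σℚ {suc n} (g ∘ toℕ) ≡ Σℚ {n} (g ∘ toℕ) +ℚ g n
Σℚ-toℕ-snoc zero    g = ℚₚ.+-comm (g 0) 0ℚ
Σℚ-toℕ-snoc (suc n) g =
  trans (cong (g 0 +ℚ_) (Σℚ-toℕ-snoc n (g ∘ suc))) (≡.sym (ℚₚ.+-assoc (g 0) _ (g (suc n))))

Σℚ-toℕ-ends : ∀ k (g : ℕ → ℚ) → Σℚ {4 ℕ.+ k} (g ∘ toℕ)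
  ≡ g 0 +ℚ (g 1 +ℚ ((Σℚ {k} (λ j → g (2 ℕ.+ toℕ j)) +ℚ g (2 ℕ.+ k)) +ℚ g (3 ℕ.+ k)))
Σℚ-toℕ-ends k g = cong (λ s → g 0 +ℚ (g 1 +ℚ s))
  (trans (Σℚ-toℕ-snoc (suc k) (g ∘ (2 ℕ.+_))) (cong (_+ℚ g (3 ℕ.+ k)) (Σℚ-toℕ-snoc k (g ∘ (2 ℕ.+_)))))

degree-sum-split : ∀ {k} (G : Graph (4 ℕ.+ k)) (F : ℕ → ℚ) → Σℚ (λ v → F (deg G v))
  ≡ F (d G 1) +ℚ (F (d G 2) +ℚ ((Σℚ (λ j → F (d G (3 ℕ.+ toℕ {k} j))) +ℚ F (d G (3 ℕ.+ k))) +ℚ F (d G (4 ℕ.+ k))))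
degree-sum-split {k} G F =
  trans (Σℚ-cong (λ v → cong F (≡.sym (d-toℕ G v)))) (Σℚ-toℕ-ends k (F ∘ d G ∘ suc))

Fin-constant⇔segment-constant : ∀ (f : ℕ → ℕ) i k →
  (∀ (a b : Fin (suc k)) → f (i ℕ.+ toℕ a) ≡ f (i ℕ.+ toℕ b)) ⇔ (∀ t → i ≤ t → t ≤ i ℕ.+ k → f t ≡ f i)
Fin-constant⇔segment-constant f i k = mk⇔ to from
  where
  to : (∀ (a b : Fin (suc k)) → f (i ℕ.+ toℕ a) ≡ f (i ℕ.+ toℕ b)) → ∀ t → i ≤ t → t ≤ i ℕ.+ k → f t ≡ f i
  to constant t i≤t t≤i+k = begin
    f t                  ≡⟨ cong f (ℕₚ.m+[n∸m]≡n i≤t) ⟨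
    f (i ℕ.+ (t ∸ i))    ≡⟨ cong (λ s → f (i ℕ.+ s)) (Finₚ.toℕ-fromℕ< t∸i<1+k) ⟨
    f (i ℕ.+ toℕ a)      ≡⟨ constant a fz ⟩
    f (i ℕ.+ 0)          ≡⟨ cong f (ℕₚ.+-identityʳ i) ⟩
    f i                  ∎
    where
    open ≡-Reasoning
    t∸i<1+k : t ∸ i ℕ.< suc k
    t∸i<1+k = s≤s (≡.subst (t ∸ i ≤_) (ℕₚ.m+n∸m≡n i k) (ℕₚ.∸-monoˡ-≤ i t≤i+k))
    a : Fin (suc k)
    a = fromℕ< t∸i<1+k
  from : (∀ t → i ≤ t → t ≤ i ℕ.+ k → f t ≡ f i) → ∀ (a b : Fin (suc k)) → f (i ℕ.+ toℕ a) ≡ f (i ℕ.+ toℕ b)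
  from constant a b = trans (constant-at a) (≡.sym (constant-at b))
    where
    constant-at : ∀ a → f (i ℕ.+ toℕ a) ≡ f i
    constant-at a = constant _ (ℕₚ.m≤m+n i (toℕ a)) (ℕₚ.+-monoʳ-≤ i (Finₚ.toℕ≤pred[n] a))

InΓ-⊆ : ∀ {n} {G : Graph n} {i j i′ j′} → i′ ≤ i → i ≤ j → j ≤ j′ → InΓ G i′ j′ → InΓ G i j
InΓ-⊆ i′≤i i≤j j≤j′ h t i≤t t≤j =
  trans (h t (ℕₚ.≤-trans i′≤i i≤t) (ℕₚ.≤-trans t≤j j≤j′)) (≡.sym (h _ i′≤i (ℕₚ.≤-trans i≤j j≤j′)))

Regular⇒InΓ : ∀ {n} {G : Graph n} {i j} → Regular G → 1 ≤ i → j ≤ n → InΓ G i j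
Regular⇒InΓ {G = G} {suc i} regular _ j≤n (suc t) i≤t t≤j =
  trans (d-fromℕ< G t<n) (trans (regular _ _) (≡.sym (d-fromℕ< G (ℕₚ.≤-trans i≤t t<n))))
  where
  t<n : t ℕ.< _
  t<n = ℕₚ.≤-trans t≤j j≤n

middle-constant⇔InΓ : ∀ {m} (G : Graph (5 ℕ.+ m)) →
  (∀ i j → inv (d G (3 ℕ.+ toℕ {suc m} i)) ≡ inv (d G (3 ℕ.+ toℕ j))) ⇔ InΓ G 3 (3 ℕ.+ m)
middle-constant⇔InΓ {m} G = ⇔.trans
  (mk⇔ (λ h a b → inv-injective _ _ (h a b)) (λ h a b → cong inv (h a b)))
  (Fin-constant⇔segment-constant (d G) 3 m)

equality-case⇒InΓ-middle : ∀ {m} (G : Graph (5 ℕ.+ m)) →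
  Regular G ⊎ InΓ G 3 (3 ℕ.+ m) ⊎ InΓ G 2 (3 ℕ.+ m) ⊎ InΓ G 3 (4 ℕ.+ m) ⊎ InΓ G 2 (4 ℕ.+ m)
    ⊎ InΓ G 3 (5 ℕ.+ m) ⊎ InΓ G 2 (5 ℕ.+ m) ⊎ InΓ G 1 (3 ℕ.+ m) ⊎ InΓ G 1 (4 ℕ.+ m)
  → InΓ G 3 (3 ℕ.+ m)
equality-case⇒InΓ-middle {m} G =
  [ (λ regular → Regular⇒InΓ regular (s≤s z≤n) (ℕₚ.m≤n+m _ 2)) , [ id ,
  [ shrink 2≤3 j₀ , [ shrink 3≤3 j₁ , [ shrink 2≤3 j₁ , [ shrink 3≤3 j₂ , [ shrink 2≤3 j₂ ,
  [ shrink 1≤3 j₀ , shrink 1≤3 j₁ ]′ ]′ ]′ ]′ ]′ ]′ ]′ ]′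
  where
  shrink : ∀ {i j} → i ≤ 3 → 3 ℕ.+ m ≤ j → InΓ G i j → InΓ G 3 (3 ℕ.+ m)
  shrink i≤3 = InΓ-⊆ i≤3 (ℕₚ.m≤m+n 3 m)
  1≤3 : 1 ≤ 3
  1≤3 = s≤s z≤n
  2≤3 : 2 ≤ 3
  2≤3 = ℕₚ.n≤1+n 2
  3≤3 : 3 ≤ 3
  3≤3 = ℕₚ.≤-refl
  j₀ : 3 ℕ.+ m ≤ 3 ℕ.+ m
  j₀ = ℕₚ.≤-refl
  j₁ : 3 ℕ.+ m ≤ 4 ℕ.+ m
  j₁ = ℕₚ.n≤1+n _
  j₂ : 3 ℕ.+ m ≤ 5 ℕ.+ m
  j₂ = ℕₚ.m≤n+m _ 2

corollary12 : ∀ (n : ℕ) (G : Graph n) → 5 ≤ n → DegNonincreasing G → 1 ≤ d G n →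
    let Δ = d G 1
        δ = d G n
        T = ID G -ℚ inv Δ -ℚ inv δ
        A = inv (d G 2) -ℚ inv (d G (n ∸ 1))
        B = (T *ℚ inv (n ∸ 2)) -ℚ ((inv (d G 2) +ℚ inv (d G (n ∸ 1))) *ℚ inv 2)
        rhs = inv Δ *ℚ inv Δ +ℚ inv δ *ℚ inv δ
              +ℚ (T *ℚ T) *ℚ inv (n ∸ 2)
              +ℚ inv 2 *ℚ (A *ℚ A)
              +ℚ (ℕ→ℚ (2 * (n ∸ 2)) *ℚ inv (n ∸ 4)) *ℚ (B *ℚ B)
    in (rhs ≤ℚ mM1 G)
       × ((mM1 G ≡ rhs)
          ⇔ (Regular G ⊎ InΓ G 3 (n ∸ 2) ⊎ InΓ G 2 (n ∸ 2) ⊎ InΓ G 3 (n ∸ 1)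
             ⊎ InΓ G 2 (n ∸ 1) ⊎ InΓ G 3 n ⊎ InΓ G 2 n ⊎ InΓ G 1 (n ∸ 2)
             ⊎ InΓ G 1 (n ∸ 1)))
corollary12 .(5 ℕ.+ m) G (s≤s (s≤s (s≤s (s≤s (s≤s (z≤n {m})))))) _ _ =
  map₂ (λ equality⇔ → let open Equivalence (⇔.trans equality⇔ (middle-constant⇔InΓ G))
                      in mk⇔ (inj₂ ∘ inj₁ ∘ to) (from ∘ equality-case⇒InΓ-middle G))
       (sum-of-squares-bound m
         (inv (d G 1)) (inv (d G (5 ℕ.+ m))) (inv (d G 2)) (inv (d G (4 ℕ.+ m))) (ID G) (mM1 G)
         (λ j → inv (d G (3 ℕ.+ toℕ j)))
         (degree-sum-split G inv) (degree-sum-split G (λ x → inv x *ℚ inv x)))
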